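{- Let $I,J,J'\in\mathcal I$ with $J\vartriangleleft I$, $J'\vartriangleleft I$, and $J\neq J'$. Then at least one of the following holds: $J'\vartriangleleft J$; $J\vartriangleleft J'$; or there is $J''\in\mathcal I$ with $J''\vartriangleleft J$ and $J''\vartriangleleft J'$.
   Context: Let $a_1,\dots,a_n$ be distinct integers between $1$ and $n$, and set $a_0=0$, so $A=(a_i)_{i=0,1,\dots,n}$. A set $I\subseteq\{0\}\cup[n]$ is feasible if $a_i<a_j$ for all $i,j\in I$ with $i<j$; $\mathcal I$ denotes the family of maximum-cardinality feasible sets. Patience sorting: start with empty piles $P_0,P_1,\dots,P_n$; for $i=0,1,\dots,n$ in this order, put $a_i$ on the top of the leftmost (smallest-index) pile $P_j$ that is empty or whose current top element is greater than $a_i$. Let $P_0,\dots,P_k$ be the resulting nonempty piles; "$a_u$ is placed below $a_v$" in a pile means $a_u$ was put on that pile before $a_v$. For $I,J\in\mathcal I$, write $I\vartriangleleft J$ if $I\setminus J=\{u\}$, $J\setminus I=\{v\}$, and $a_u$ is placed strictly below $a_v$ on the same pile $P_i$ for some $1\le i\le k$. -}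

module Defs where

open import Data.Nat using (ℕ; zero; suc; _<_; _≤_; _<ᵇ_; _<?_)
open import Data.Fin using (Fin; toℕ; fromℕ<)
open import Data.Fin.Subset using (Subset; _∈_; _─_; ⁅_⁆; ∣_∣)
open import Data.List using (List; []; _∷_)
open import Data.Product using (_×_; _,_; proj₁; proj₂; ∃₂)
open import Data.Bool using (if_then_else_)
open import Relation.Nullary using (yes; no)
open import Relation.Binary.PropositionalEquality using (_≡_)

-- The data: n and a permutation a₁,…,aₙ of 1..n, given as an injective map
-- a : Fin n → Fin n, where index i : Fin n stands for position i+1 and
-- value v : Fin n stands for the integer v+1.
-- The extended sequence A = (a_0 = 0, a_1, …, a_n) indexed by Fin (suc n).
Aseq : ∀ {n} → (Fin n → Fin n) → Fin (suc n) → ℕ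
Aseq a Fin.zero    = 0
Aseq a (Fin.suc i) = suc (toℕ (a i))

-- Same sequence indexed by ℕ (values past n are irrelevant; set to 0).
Aℕ : ∀ {n} → (Fin n → Fin n) → ℕ → ℕ
Aℕ a zero = 0
Aℕ {n} a (suc k) with k <? n
... | yes k<n = suc (toℕ (a (fromℕ< k<n)))
... | no _    = 0

-- Feasible sets (increasing subsequences, as index sets, over {0} ∪ [n]).
Feasible : ∀ {n} → (Fin n → Fin n) → Subset (suc n) → Set
Feasible a I = ∀ i j → i ∈ I → j ∈ I → toℕ i < toℕ j → Aseq a i < Aseq a j

MaxFeasible : ∀ {n} → (Fin n → Fin n) → Subset (suc n) → Set
MaxFeasible a I = Feasible a I × (∀ K → Feasible a K → ∣ K ∣ ≤ ∣ I ∣)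

-- Patience sorting. The state is the list of current pile tops
-- (pile 0 first).
place : List ℕ → ℕ → ℕ × List ℕ
place []       x = 0 , x ∷ []
place (t ∷ ts) x = if x <ᵇ t then (0 , x ∷ ts)
                   else (suc (proj₁ (place ts x)) , t ∷ proj₂ (place ts x))

tops : ∀ {n} → (Fin n → Fin n) → ℕ → List ℕ
tops a zero    = []
tops a (suc k) = proj₂ (place (tops a k) (Aℕ a k))

pileOf : ∀ {n} → (Fin n → Fin n) → ℕ → ℕ
pileOf a k = proj₁ (place (tops a k) (Aℕ a k))

-- a_u is placed strictly below a_v on the same pile P_i with 1 ≤ i:
-- same pile index ≥ 1, and a_u was put there before a_v (u < v, since
-- elements are processed in index order).
BelowSamePile : ∀ {n} → (Fin n → Fin n) → Fin (suc n) → Fin (suc n) → Set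
BelowSamePile a u v =
  pileOf a (toℕ u) ≡ pileOf a (toℕ v) × 1 ≤ pileOf a (toℕ u) × toℕ u < toℕ v

◁ : ∀ {n} → (Fin n → Fin n) → Subset (suc n) → Subset (suc n) → Set
◁ a I J = ∃₂ λ u v → (I ─ J ≡ ⁅ u ⁆) × (J ─ I ≡ ⁅ v ⁆) × BelowSamePile a u v

{-# OPTIONS --safe #-}
module Submission where

open import Defs
open import Data.Nat using (ℕ; suc)
open import Data.Fin using (Fin)
open import Data.Fin.Subset using (Subset)
open import Data.Product using (_×_; ∃)
open import Data.Sum using (_⊎_)
open import Function.Definitions using (Injective)
open import Relation.Binary.PropositionalEquality using (_≡_)
open import Relation.Nullary using (¬_)

open import Data.Bool using (true; false; not; _∧_)
open import Data.Bool.Properties using (∧-zeroʳ; ∧-identityʳ; ∧-inverseʳ; ¬-not)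
open import Data.Empty using (⊥-elim)
open import Function using (_∘_)
open import Data.Fin using (zero; suc; toℕ; _≟_)
open import Data.Fin.Properties using (toℕ-injective; toℕ<n; fromℕ<-toℕ)
open import Data.Fin.Subset using (_∈_; _∉_; _─_; ⁅_⁆; ∣_∣; inside; outside)
open import Data.Fin.Subset.Properties using (x∈⁅x⁆; x≢y⇒x∉⁅y⁆; ∣⁅x⁆∣≡1)
open import Data.List using (List; []; _∷_)
open import Data.Nat using (zero; _<_; _≤_; _+_; _<ᵇ_; _<?_; z<s; s<s)
open import Data.Nat.Properties
  using (<ᵇ-reflects-<; ≤-refl; ≤-trans; <⇒≤; ≮⇒≥; <-trans; <-asym; <-irrefl; ≤-<-trans;
         <-cmp; m<1+n⇒m<n∨m≡n; suc-injective; +-suc; +-cancelʳ-≡)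
open import Data.Product using (_,_; proj₁; proj₂; ∃₂)
open import Data.Sum as Sum using (inj₁; inj₂)
open import Data.Vec using ([]; _∷_; lookup; _[_]≔_)
open import Data.Vec.Properties
  using ([]=⇒lookup; lookup⇒[]=; tabulate∘lookup; tabulate-cong; lookup∘update; lookup∘update′)
open import Relation.Binary.Definitions using (tri<; tri≈; tri>)
open import Relation.Binary.PropositionalEquality
  using (refl; sym; trans; cong; subst; subst₂; _≢_; ≢-sym; module ≡-Reasoning)
open import Relation.Nullary using (yes; no)
open import Relation.Nullary.Reflects using (ofʸ; ofⁿ)

-- Write J ◁ I as the swap J = I − v + u, with u placed below v on one pile. Patience sorting
-- puts a later, larger element on a pile strictly to the right, so the elements of a
-- feasible set lie on distinct piles, in increasing order, and each pile decreases upward.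
-- If v and v′ lie on the same pile they coincide, and J, J′ differ by exchanging u and u′,
-- which share that pile: the lower one gives J ◁ J′ or J′ ◁ J. Otherwise, say pile v < pile v′;
-- then J″ = I − v − v′ + u + u′ has the size of J and is feasible, because the only pair of
-- it lying in neither J nor J′ is (u, u′), and comparing piles in J, in J′ and along the pile
-- of v′ gives u < v < u′ and a_u < a_v′ < a_u′.

data Tops≤ (c : ℕ) : ℕ → List ℕ → Set where
  [_] : ∀ {t ts} → t ≤ c → Tops≤ c zero (t ∷ ts)
  _∷_ : ∀ {t ts p} → t ≤ c → Tops≤ c p ts → Tops≤ c (suc p) (t ∷ ts)

Tops≤-head : ∀ {c p t ts} → Tops≤ c p (t ∷ ts) → t ≤ c
Tops≤-head [ t≤c ]   = t≤c
Tops≤-head (t≤c ∷ _) = t≤c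

Tops≤-lower-head : ∀ {c p x t ts} → x ≤ t → Tops≤ c p (t ∷ ts) → Tops≤ c p (x ∷ ts)
Tops≤-lower-head x≤t [ t≤c ]     = [ ≤-trans x≤t t≤c ]
Tops≤-lower-head x≤t (t≤c ∷ tops) = ≤-trans x≤t t≤c ∷ tops

place-preserves-Tops≤ : ∀ {c p} ts x → Tops≤ c p ts → Tops≤ c p (proj₂ (place ts x))
place-preserves-Tops≤ (t ∷ ts) x tops with x <ᵇ t | <ᵇ-reflects-< x t
... | true  | ofʸ x<t = Tops≤-lower-head (<⇒≤ x<t) tops
place-preserves-Tops≤ (t ∷ ts) x [ t≤c ]      | false | _ = [ t≤c ]
place-preserves-Tops≤ (t ∷ ts) x (t≤c ∷ tops) | false | _ = t≤c ∷ place-preserves-Tops≤ ts x tops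

place-Tops≤-self : ∀ ts x → Tops≤ x (proj₁ (place ts x)) (proj₂ (place ts x))
place-Tops≤-self []       x = [ ≤-refl ]
place-Tops≤-self (t ∷ ts) x with x <ᵇ t | <ᵇ-reflects-< x t
... | true  | _       = [ ≤-refl ]
... | false | ofⁿ x≮t = ≮⇒≥ x≮t ∷ place-Tops≤-self ts x

place-beyond-Tops≤ : ∀ {c p} ts x → Tops≤ c p ts → c < x → p < proj₁ (place ts x)
place-beyond-Tops≤ (t ∷ ts) x tops c<x with x <ᵇ t | <ᵇ-reflects-< x t
... | true  | ofʸ x<t = ⊥-elim (<-asym x<t (≤-<-trans (Tops≤-head tops) c<x))
place-beyond-Tops≤ (t ∷ ts) x [ _ ]      c<x | false | _ = z<s
place-beyond-Tops≤ (t ∷ ts) x (_ ∷ tops) c<x | false | _ = s<s (place-beyond-Tops≤ ts x tops c<x)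

module _ {n : ℕ} (a : Fin n → Fin n) where

  tops-Tops≤ : ∀ {k l} → k < l → Tops≤ (Aℕ a k) (pileOf a k) (tops a l)
  tops-Tops≤ {k} {suc l} k<1+l with m<1+n⇒m<n∨m≡n k<1+l
  ... | inj₁ k<l  = place-preserves-Tops≤ (tops a l) (Aℕ a l) (tops-Tops≤ k<l)
  ... | inj₂ refl = place-Tops≤-self (tops a k) (Aℕ a k)

  pileOf-< : ∀ {k l} → k < l → Aℕ a k < Aℕ a l → pileOf a k < pileOf a l
  pileOf-< {k} {l} k<l = place-beyond-Tops≤ (tops a l) (Aℕ a l) (tops-Tops≤ k<l)

  Aℕ-toℕ : (i : Fin (suc n)) → Aℕ a (toℕ i) ≡ Aseq a i
  Aℕ-toℕ zero = refl
  Aℕ-toℕ (suc j) with toℕ j <? n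
  ... | yes j<n = cong (λ k → suc (toℕ (a k))) (fromℕ<-toℕ j j<n)
  ... | no  j≮n = ⊥-elim (j≮n (toℕ<n j))

∣p∣+∣q─p∣≡∣q∣+∣p─q∣ : ∀ {m} (p q : Subset m) → ∣ p ∣ + ∣ q ─ p ∣ ≡ ∣ q ∣ + ∣ p ─ q ∣
∣p∣+∣q─p∣≡∣q∣+∣p─q∣ []          []          = refl
∣p∣+∣q─p∣≡∣q∣+∣p─q∣ (true  ∷ p) (true  ∷ q) = cong suc (∣p∣+∣q─p∣≡∣q∣+∣p─q∣ p q)
∣p∣+∣q─p∣≡∣q∣+∣p─q∣ (true  ∷ p) (false ∷ q) =
  trans (cong suc (∣p∣+∣q─p∣≡∣q∣+∣p─q∣ p q)) (sym (+-suc ∣ q ∣ ∣ p ─ q ∣))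
∣p∣+∣q─p∣≡∣q∣+∣p─q∣ (false ∷ p) (true  ∷ q) =
  trans (+-suc ∣ p ∣ ∣ q ─ p ∣) (cong suc (∣p∣+∣q─p∣≡∣q∣+∣p─q∣ p q))
∣p∣+∣q─p∣≡∣q∣+∣p─q∣ (false ∷ p) (false ∷ q) = ∣p∣+∣q─p∣≡∣q∣+∣p─q∣ p q

lookup-─ : ∀ {m} (p q : Subset m) x → lookup (p ─ q) x ≡ lookup p x ∧ not (lookup q x)
lookup-─ (b ∷ _) (true  ∷ _) zero    = sym (∧-zeroʳ b)
lookup-─ (b ∷ _) (false ∷ _) zero    = sym (∧-identityʳ b)
lookup-─ (_ ∷ p) (_ ∷ q)     (suc x) = lookup-─ p q x

∧-not≡true : ∀ {b c} → b ∧ not c ≡ true → b ≡ true × c ≡ false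
∧-not≡true {true} {false} _ = refl , refl

∧-not-antisym : ∀ {b c} → b ∧ not c ≡ false → c ∧ not b ≡ false → b ≡ c
∧-not-antisym {true}  {true}  _ _ = refl
∧-not-antisym {false} {false} _ _ = refl

module _ {m : ℕ} where

  lookup-ext : {p q : Subset m} → (∀ x → lookup p x ≡ lookup q x) → p ≡ q
  lookup-ext {p} {q} p≗q =
    trans (sym (tabulate∘lookup p)) (trans (tabulate-cong p≗q) (tabulate∘lookup q))

  ∉⇒lookup≡false : ∀ {p : Subset m} {x} → x ∉ p → lookup p x ≡ false
  ∉⇒lookup≡false {p} {x} x∉p = ¬-not (λ e → x∉p (lookup⇒[]= x p e))

  lookup≡false⇒∉ : ∀ {p : Subset m} {x} → lookup p x ≡ false → x ∉ p
  lookup≡false⇒∉ e x∈p with trans (sym e) ([]=⇒lookup x∈p)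
  ... | ()

  lookup-⁅x⁆ : ∀ (x : Fin m) → lookup ⁅ x ⁆ x ≡ true
  lookup-⁅x⁆ x = []=⇒lookup (x∈⁅x⁆ x)

  lookup-⁅y⁆ : ∀ {x y : Fin m} → x ≢ y → lookup ⁅ y ⁆ x ≡ false
  lookup-⁅y⁆ x≢y = ∉⇒lookup≡false (x≢y⇒x∉⁅y⁆ x≢y)

  ∈∉⇒≢ : ∀ {p : Subset m} {x y} → x ∈ p → y ∉ p → x ≢ y
  ∈∉⇒≢ x∈p y∉p refl = y∉p x∈p

  record Swap (I J : Subset m) (u v : Fin m) : Set where
    field
      u∈J : u ∈ J
      u∉I : u ∉ I
      v∈I : v ∈ I
      v∉J : v ∉ J
      elsewhere : ∀ {x} → x ≢ u → x ≢ v → lookup J x ≡ lookup I x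

  module _ {I J : Subset m} {u v : Fin m} (s : Swap I J u v) where
    open Swap s

    Swap-flip : Swap J I v u
    Swap-flip = record
      { u∈J = v∈I ; u∉I = v∉J ; v∈I = u∈J ; v∉J = u∉I
      ; elsewhere = λ x≢v x≢u → sym (elsewhere x≢u x≢v) }

    Swap-u≢v : u ≢ v
    Swap-u≢v = ≢-sym (∈∉⇒≢ v∈I u∉I)

    Swap-keeps-∈ : ∀ {x} → x ≢ u → x ≢ v → x ∈ I → x ∈ J
    Swap-keeps-∈ {x} x≢u x≢v x∈I = lookup⇒[]= x J (trans (elsewhere x≢u x≢v) ([]=⇒lookup x∈I))

    Swap-⊆ : ∀ {x} → x ∈ J → x ≢ u → x ∈ I
    Swap-⊆ {x} x∈J x≢u with x ≟ v
    ... | yes refl = ⊥-elim (v∉J x∈J)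
    ... | no  x≢v  = lookup⇒[]= x I (trans (sym (elsewhere x≢u x≢v)) ([]=⇒lookup x∈J))

    Swap⇒─ : J ─ I ≡ ⁅ u ⁆
    Swap⇒─ = lookup-ext λ x → trans (lookup-─ J I x) (added x)
      where
      added : ∀ x → lookup J x ∧ not (lookup I x) ≡ lookup ⁅ u ⁆ x
      added x with x ≟ u
      ... | yes refl rewrite []=⇒lookup u∈J | ∉⇒lookup≡false u∉I | lookup-⁅x⁆ u = refl
      ... | no x≢u with x ≟ v
      ...   | yes refl rewrite ∉⇒lookup≡false v∉J | lookup-⁅y⁆ x≢u = refl
      ...   | no  x≢v  rewrite elsewhere x≢u x≢v | lookup-⁅y⁆ x≢u = ∧-inverseʳ (lookup I x)

  module _ {I J : Subset m} {u v : Fin m} (s : Swap I J u v) where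
    open Swap s

    Swap-keeps-∉ : ∀ {x} → x ≢ u → x ≢ v → x ∉ I → x ∉ J
    Swap-keeps-∉ x≢u x≢v x∉I x∈J = x∉I (Swap-keeps-∈ (Swap-flip s) x≢v x≢u x∈J)

    Swap-∣∣ : ∣ J ∣ ≡ ∣ I ∣
    Swap-∣∣ = +-cancelʳ-≡ 1 ∣ J ∣ ∣ I ∣ (begin
      ∣ J ∣ + 1         ≡⟨ cong (∣ J ∣ +_) (∣⁅x⁆∣≡1 v) ⟨
      ∣ J ∣ + ∣ ⁅ v ⁆ ∣ ≡⟨ cong (λ p → ∣ J ∣ + ∣ p ∣) (Swap⇒─ (Swap-flip s)) ⟨
      ∣ J ∣ + ∣ I ─ J ∣ ≡⟨ ∣p∣+∣q─p∣≡∣q∣+∣p─q∣ I J ⟨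
      ∣ I ∣ + ∣ J ─ I ∣ ≡⟨ cong (λ p → ∣ I ∣ + ∣ p ∣) (Swap⇒─ s) ⟩
      ∣ I ∣ + ∣ ⁅ u ⁆ ∣ ≡⟨ cong (∣ I ∣ +_) (∣⁅x⁆∣≡1 u) ⟩
      ∣ I ∣ + 1         ∎)
      where open ≡-Reasoning

  ─⇒Swap : ∀ {I J : Subset m} {u v} → J ─ I ≡ ⁅ u ⁆ → I ─ J ≡ ⁅ v ⁆ → Swap I J u v
  ─⇒Swap {I} {J} {u} {v} J─I≡u I─J≡v = record
    { u∈J = lookup⇒[]= u J (proj₁ J[u]∧¬I[u])
    ; u∉I = lookup≡false⇒∉ (proj₂ J[u]∧¬I[u])
    ; v∈I = lookup⇒[]= v I (proj₁ I[v]∧¬J[v])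
    ; v∉J = lookup≡false⇒∉ (proj₂ I[v]∧¬J[v])
    ; elsewhere = λ {x} x≢u x≢v →
        ∧-not-antisym (trans (difference J─I≡u x) (lookup-⁅y⁆ x≢u))
                      (trans (difference I─J≡v x) (lookup-⁅y⁆ x≢v)) }
    where
    difference : ∀ {p q : Subset m} {w} → p ─ q ≡ ⁅ w ⁆ → ∀ x →
                 lookup p x ∧ not (lookup q x) ≡ lookup ⁅ w ⁆ x
    difference {p} {q} p─q≡w x = trans (sym (lookup-─ p q x)) (cong (λ r → lookup r x) p─q≡w)
    J[u]∧¬I[u] = ∧-not≡true (trans (difference J─I≡u u) (lookup-⁅x⁆ u))
    I[v]∧¬J[v] = ∧-not≡true (trans (difference I─J≡v v) (lookup-⁅x⁆ v))

  Swap-lookup-cong : ∀ {I J I′ J′ : Subset m} {u v} → Swap I J u v → Swap I′ J′ u v →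
                     ∀ x → (x ≢ u → x ≢ v → lookup I x ≡ lookup I′ x) → lookup J x ≡ lookup J′ x
  Swap-lookup-cong {u = u} {v} s s′ x I≗I′ with x ≟ u
  ... | yes refl = trans ([]=⇒lookup (Swap.u∈J s)) (sym ([]=⇒lookup (Swap.u∈J s′)))
  ... | no x≢u with x ≟ v
  ...   | yes refl = trans (∉⇒lookup≡false (Swap.v∉J s)) (sym (∉⇒lookup≡false (Swap.v∉J s′)))
  ...   | no  x≢v  = trans (Swap.elsewhere s x≢u x≢v)
                       (trans (I≗I′ x≢u x≢v) (sym (Swap.elsewhere s′ x≢u x≢v)))

  Swap-unique : ∀ {I J J′ : Subset m} {u v} → Swap I J u v → Swap I J′ u v → J ≡ J′
  Swap-unique s s′ = lookup-ext λ x → Swap-lookup-cong s s′ x λ _ _ → refl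

  Swap-same-removed : ∀ {I J J′ : Subset m} {u u′ v} → Swap I J u v → Swap I J′ u′ v → u ≢ u′ →
                      Swap J′ J u u′
  Swap-same-removed {u = u} {u′} {v} s s′ u≢u′ = record
    { u∈J = u∈J s
    ; u∉I = Swap-keeps-∉ s′ u≢u′ (Swap-u≢v s) (u∉I s)
    ; v∈I = u∈J s′
    ; v∉J = Swap-keeps-∉ s (≢-sym u≢u′) (Swap-u≢v s′) (u∉I s′)
    ; elsewhere = elsewhere′ }
    where
    open Swap
    elsewhere′ : ∀ {x} → x ≢ u → x ≢ u′ → _
    elsewhere′ {x} x≢u x≢u′ with x ≟ v
    ... | yes refl = trans (∉⇒lookup≡false (v∉J s)) (sym (∉⇒lookup≡false (v∉J s′)))
    ... | no  x≢v  = trans (elsewhere s x≢u x≢v) (sym (elsewhere s′ x≢u′ x≢v))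

swap : ∀ {m} → Subset m → Fin m → Fin m → Subset m
swap S u v = S [ v ]≔ outside [ u ]≔ inside

module _ {m : ℕ} where

  swap-Swap : ∀ {S : Subset m} {u v} → u ∉ S → v ∈ S → Swap S (swap S u v) u v
  swap-Swap {S} {u} {v} u∉S v∈S = record
    { u∈J = lookup⇒[]= u _ (lookup∘update u S-v inside)
    ; u∉I = u∉S
    ; v∈I = v∈S
    ; v∉J = lookup≡false⇒∉ (trans (lookup∘update′ (∈∉⇒≢ v∈S u∉S) S-v inside)
                                  (lookup∘update v S outside))
    ; elsewhere = λ x≢u x≢v → trans (lookup∘update′ x≢u S-v inside) (lookup∘update′ x≢v S outside) }
    where
    S-v = S [ v ]≔ outside

  Swap-commute : ∀ {I J J′ : Subset m} {u v u′ v′} → Swap I J u v → Swap I J′ u′ v′ →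
                 u ≢ u′ → v ≢ v′ →
                 Swap J (swap J u′ v′) u′ v′ × Swap J′ (swap J u′ v′) u v
  Swap-commute s s′ u≢u′ v≢v′ = s″ , record
    { u∈J = Swap-keeps-∈ s″ u≢u′ u≢v′ (u∈J s)
    ; u∉I = Swap-keeps-∉ s′ u≢u′ u≢v′ (u∉I s)
    ; v∈I = Swap-keeps-∈ s′ v≢u′ v≢v′ (v∈I s)
    ; v∉J = Swap-keeps-∉ s″ v≢u′ v≢v′ (v∉J s)
    ; elsewhere = λ {x} x≢u x≢v → Swap-lookup-cong s″ s′ x λ _ _ → elsewhere s x≢u x≢v }
    where
    open Swap
    u≢v′ = ≢-sym (∈∉⇒≢ (v∈I s′) (u∉I s))
    v≢u′ = ∈∉⇒≢ (v∈I s) (u∉I s′)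
    s″ = swap-Swap (Swap-keeps-∉ s (≢-sym u≢u′) (≢-sym v≢u′) (u∉I s′))
                   (Swap-keeps-∈ s (≢-sym u≢v′) (≢-sym v≢v′) (v∈I s′))

module _ {n : ℕ} (a : Fin n → Fin n) where

  pile : Fin (suc n) → ℕ
  pile x = pileOf a (toℕ x)

  pile-increasing : ∀ {x y} → toℕ x < toℕ y → Aseq a x < Aseq a y → pile x < pile y
  pile-increasing {x} {y} x<y Ax<Ay =
    pileOf-< a x<y (subst₂ _<_ (sym (Aℕ-toℕ a x)) (sym (Aℕ-toℕ a y)) Ax<Ay)

  Feasible-pile-injective : ∀ {S x y} → Feasible a S → x ∈ S → y ∈ S → pile x ≡ pile y → x ≡ y
  Feasible-pile-injective {x = x} {y} fS x∈S y∈S px≡py with <-cmp (toℕ x) (toℕ y)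
  ... | tri< x<y _ _ = ⊥-elim (<-irrefl px≡py (pile-increasing x<y (fS x y x∈S y∈S x<y)))
  ... | tri≈ _ x≡y _ = toℕ-injective x≡y
  ... | tri> _ _ y<x = ⊥-elim (<-irrefl (sym px≡py) (pile-increasing y<x (fS y x y∈S x∈S y<x)))

  Feasible-pile-ordered : ∀ {S x y} → Feasible a S → x ∈ S → y ∈ S → pile x < pile y →
                          toℕ x < toℕ y × Aseq a x < Aseq a y
  Feasible-pile-ordered {x = x} {y} fS x∈S y∈S px<py with <-cmp (toℕ x) (toℕ y)
  ... | tri< x<y _ _ = x<y , fS x y x∈S y∈S x<y
  ... | tri≈ _ x≡y _ = ⊥-elim (<-irrefl (cong pile (toℕ-injective x≡y)) px<py)
  ... | tri> _ _ y<x = ⊥-elim (<-asym px<py (pile-increasing y<x (fS y x y∈S x∈S y<x)))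

  Feasible-glue : ∀ {S T K p q} → Feasible a S → Feasible a T →
                  (∀ {x} → x ∈ K → x ≢ p → x ∈ S) → (∀ {x} → x ∈ K → x ≢ q → x ∈ T) →
                  toℕ q < toℕ p → Aseq a q < Aseq a p → Feasible a K
  Feasible-glue {p = p} {q} fS fT K⊆S K⊆T q<p Aq<Ap i j i∈K j∈K i<j with i ≟ p | j ≟ p
  ... | no i≢p   | no j≢p   = fS i j (K⊆S i∈K i≢p) (K⊆S j∈K j≢p) i<j
  ... | yes refl | yes refl = ⊥-elim (<-irrefl refl i<j)
  ... | yes refl | no j≢p with j ≟ q
  ...   | yes refl = ⊥-elim (<-asym q<p i<j)
  ...   | no  j≢q  = fT i j (K⊆T i∈K (λ { refl → <-irrefl refl q<p })) (K⊆T j∈K j≢q) i<j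
  Feasible-glue {p = p} {q} fS fT K⊆S K⊆T q<p Aq<Ap i j i∈K j∈K i<j | no i≢p | yes refl with i ≟ q
  ...   | yes refl = Aq<Ap
  ...   | no  i≢q  = fT i j (K⊆T i∈K i≢q) (K⊆T j∈K (λ { refl → <-irrefl refl q<p })) i<j

  Swap⇒◁ : ∀ {I J u v} → Swap I J u v → BelowSamePile a u v → ◁ a J I
  Swap⇒◁ s u▿v = _ , _ , Swap⇒─ s , Swap⇒─ (Swap-flip s) , u▿v

  ◁⇒Swap : ∀ {I J} → ◁ a J I → ∃₂ λ u v → Swap I J u v × BelowSamePile a u v
  ◁⇒Swap (u , v , J─I≡u , I─J≡v , u▿v) = u , v , ─⇒Swap J─I≡u I─J≡v , u▿v

  ◁-same-removed : ∀ {I J J′ u u′ v} → Swap I J u v → Swap I J′ u′ v →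
                   BelowSamePile a u v → BelowSamePile a u′ v → J ≢ J′ → ◁ a J′ J ⊎ ◁ a J J′
  ◁-same-removed {u = u} {u′} s s′ (pu≡pv , 1≤pu , _) (pu′≡pv , 1≤pu′ , _) J≢J′
    with <-cmp (toℕ u) (toℕ u′)
  ... | tri< u<u′ u≢u′ _ =
    inj₂ (Swap⇒◁ (Swap-same-removed s s′ (u≢u′ ∘ cong toℕ)) (trans pu≡pv (sym pu′≡pv) , 1≤pu , u<u′))
  ... | tri≈ _ u≡u′ _ with toℕ-injective u≡u′
  ...   | refl = ⊥-elim (J≢J′ (Swap-unique s s′))
  ◁-same-removed {u = u} {u′} s s′ (pu≡pv , 1≤pu , _) (pu′≡pv , 1≤pu′ , _) J≢J′
      | tri> _ u≢u′ u′<u =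
    inj₁ (Swap⇒◁ (Swap-same-removed s′ s (u≢u′ ∘ cong toℕ ∘ sym)) (trans pu′≡pv (sym pu≡pv) , 1≤pu′ , u′<u))

module _ {n : ℕ} {a : Fin n → Fin n} (inj : Injective _≡_ _≡_ a) where

  Aseq-injective : Injective _≡_ _≡_ (Aseq a)
  Aseq-injective {zero}  {zero}  _  = refl
  Aseq-injective {suc x} {suc y} Ax≡Ay = cong suc (inj (toℕ-injective (suc-injective Ax≡Ay)))

  pile-decreasing : ∀ {x y} → toℕ x < toℕ y → pile a x ≡ pile a y → Aseq a y < Aseq a x
  pile-decreasing {x} {y} x<y px≡py with <-cmp (Aseq a x) (Aseq a y)
  ... | tri< Ax<Ay _ _ = ⊥-elim (<-irrefl px≡py (pile-increasing a x<y Ax<Ay))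
  ... | tri≈ _ Ax≡Ay _ = ⊥-elim (<-irrefl (cong toℕ (Aseq-injective Ax≡Ay)) x<y)
  ... | tri> _ _ Ay<Ax = Ay<Ax

  ◁-common-lower : ∀ {I J J′ u v u′ v′} → MaxFeasible a J → Feasible a J′ →
                   Swap I J u v → Swap I J′ u′ v′ →
                   BelowSamePile a u v → BelowSamePile a u′ v′ → pile a v < pile a v′ →
                   ∃ λ J″ → MaxFeasible a J″ × ◁ a J″ J × ◁ a J″ J′
  ◁-common-lower {J = J} {u = u} {v} {u′} {v′} (fJ , maxJ) fJ′ s s′
                 u▿v@(pu≡pv , _ , u<v) u′▿v′@(pu′≡pv′ , _ , u′<v′) pv<pv′ =
    swap J u′ v′ , (feasible , maximal) , Swap⇒◁ a J→J″ u′▿v′ , Swap⇒◁ a J′→J″ u▿v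
    where
    open Swap
    u≢u′ : u ≢ u′
    u≢u′ refl = <-irrefl (trans (sym pu≡pv) pu′≡pv′) pv<pv′
    v≢v′ : v ≢ v′
    v≢v′ refl = <-irrefl refl pv<pv′
    J→J″ = proj₁ (Swap-commute s s′ u≢u′ v≢v′)
    J′→J″ = proj₂ (Swap-commute s s′ u≢u′ v≢v′)
    v′∈J = Swap-keeps-∈ s (∈∉⇒≢ (v∈I s′) (u∉I s)) (≢-sym v≢v′) (v∈I s′)
    v∈J′ = Swap-keeps-∈ s′ (∈∉⇒≢ (v∈I s) (u∉I s′)) v≢v′ (v∈I s)
    u<v′×Au<Av′ = Feasible-pile-ordered a fJ (u∈J s) v′∈J (subst (_< pile a v′) (sym pu≡pv) pv<pv′)
    v<u′ = proj₁ (Feasible-pile-ordered a fJ′ v∈J′ (u∈J s′) (subst (pile a v <_) (sym pu′≡pv′) pv<pv′))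
    feasible : Feasible a (swap J u′ v′)
    feasible = Feasible-glue a fJ fJ′ (Swap-⊆ J→J″) (Swap-⊆ J′→J″) (<-trans u<v v<u′)
                 (<-trans (proj₂ u<v′×Au<Av′) (pile-decreasing u′<v′ pu′≡pv′))
    maximal : ∀ K → Feasible a K → ∣ K ∣ ≤ ∣ swap J u′ v′ ∣
    maximal K fK = subst (∣ K ∣ ≤_) (sym (Swap-∣∣ J→J″)) (maxJ K fK)

lemma1 : (n : ℕ) (a : Fin n → Fin n) → Injective _≡_ _≡_ a →
         (I J J′ : Subset (suc n)) →
         MaxFeasible a I → MaxFeasible a J → MaxFeasible a J′ →
         ◁ a J I → ◁ a J′ I → ¬ (J ≡ J′) →
         ◁ a J′ J ⊎ ◁ a J J′ ⊎
           ∃ (λ J″ → MaxFeasible a J″ × ◁ a J″ J × ◁ a J″ J′)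
lemma1 n a inj I J J′ (fI , _) mJ mJ′ J◁I J′◁I J≢J′
  with ◁⇒Swap a J◁I | ◁⇒Swap a J′◁I
... | u , v , s , u▿v | u′ , v′ , s′ , u′▿v′ with <-cmp (pile a v) (pile a v′)
...   | tri< pv<pv′ _ _ = inj₂ (inj₂ (◁-common-lower inj mJ (proj₁ mJ′) s s′ u▿v u′▿v′ pv<pv′))
...   | tri≈ _ pv≡pv′ _ with Feasible-pile-injective a fI (Swap.v∈I s) (Swap.v∈I s′) pv≡pv′
...     | refl = Sum.map₂ inj₁ (◁-same-removed a s s′ u▿v u′▿v′ J≢J′)
lemma1 n a inj I J J′ (fI , _) mJ mJ′ J◁I J′◁I J≢J′
    | u , v , s , u▿v | u′ , v′ , s′ , u′▿v′ | tri> _ _ pv′<pv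
  with ◁-common-lower inj mJ′ (proj₁ mJ) s′ s u′▿v′ u▿v pv′<pv
... | J″ , mJ″ , J″◁J′ , J″◁J = inj₂ (inj₂ (J″ , mJ″ , J″◁J , J″◁J′))
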